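{- Let $G$ be a finite simple graph. Then $\operatorname{core}(G)$ is critical if and only if there is a matching from $N(\operatorname{core}(G))$ into $\operatorname{core}(G)$.
   Context: $\operatorname{core}(G)$ is the intersection of all maximum independent sets of $G$. For $A\subseteq V(G)$, $N(A)$ is the set of vertices adjacent to some vertex of $A$, $d(A)=|A|-|N(A)|$, $d_c(G)=\max\{d(A):A\subseteq V(G)\}$, and $A$ is critical if $d(A)=d_c(G)$. For disjoint $A,B\subseteq V(G)$, a matching from $A$ into $B$ is a matching in which every edge joins a vertex of $A$ and a vertex of $B$ and every vertex of $A$ is matched. -}

module Defs where

open import Data.Nat using (ℕ; _≤_)
open import Data.Integer using (ℤ; _-_; +_) renaming (_≤_ to _≤ℤ_)
open import Data.Bool using (Bool; true; false; _∧_; _∨_)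
open import Data.Fin using (Fin; zero; suc)
open import Data.Fin.Subset using (Subset; _∈_; ∣_∣; inside; outside)
open import Data.Vec using (tabulate)
open import Data.Product using (Σ; _×_)
open import Relation.Binary.PropositionalEquality using (_≡_)
open import Relation.Nullary using (¬_)

record Graph (n : ℕ) : Set where
  field
    adj   : Fin n → Fin n → Bool
    sym   : ∀ x y → adj x y ≡ adj y x
    irrefl : ∀ x → adj x x ≡ false
open Graph public

Adj : ∀ {n} → Graph n → Fin n → Fin n → Set
Adj G x y = adj G x y ≡ true

anyFin : ∀ {n} → (Fin n → Bool) → Bool
anyFin {ℕ.zero} f = false
anyFin {ℕ.suc n} f = f zero ∨ anyFin (λ i → f (suc i))

mem : ∀ {n} → Subset n → Fin n → Bool
mem A x = Data.Vec.lookup A x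

N : ∀ {n} → Graph n → Subset n → Subset n
N G A = tabulate (λ x → anyFin (λ a → mem A a ∧ adj G x a))

d : ∀ {n} → Graph n → Subset n → ℤ
d G A = + ∣ A ∣ - + ∣ N G A ∣

-- A is critical iff d(A) = d_c(G) = max { d(B) : B ⊆ V(G) }
Critical : ∀ {n} → Graph n → Subset n → Set
Critical G A = ∀ (B : Subset _) → d G B ≤ℤ d G A

Independent : ∀ {n} → Graph n → Subset n → Set
Independent G S = ∀ x y → x ∈ S → y ∈ S → ¬ Adj G x y

MaximumIndependent : ∀ {n} → Graph n → Subset n → Set
MaximumIndependent G S =
  Independent G S × (∀ T → Independent G T → ∣ T ∣ ≤ ∣ S ∣)

IsCore : ∀ {n} → Graph n → Subset n → Set
IsCore G C = ∀ x → (x ∈ C → ∀ S → MaximumIndependent G S → x ∈ S)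
                 × ((∀ S → MaximumIndependent G S → x ∈ S) → x ∈ C)

MatchingInto : ∀ {n} → Graph n → Subset n → Subset n → Set
MatchingInto {n} G A B =
  Σ (Fin n → Fin n) λ f →
      (∀ x → x ∈ A → f x ∈ B × Adj G x (f x))
    × (∀ x y → x ∈ A → y ∈ A → f x ≡ f y → x ≡ y)

-- (⇒) holds for every critical set c: for s ⊆ N(c), comparing d(c) with d(c ─ N(s)) gives
-- |s| ≤ |c ∩ N(s)|, which is Hall's condition for matching N(c) into c.
-- (⇐) Every p has d(p) ≤ d(p ─ N(p)) with p ─ N(p) independent, and an independent p has
-- d(p) ≤ d(p ∩ s) for every maximum independent set s.  Intersecting p with maximum independent
-- sets therefore shrinks it into the core without decreasing d, and for subsets of the core the
-- matching injects N(core) ─ N(p) into core ─ p, so d(p) ≤ d(core).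
module Submission where

open import Defs
open import Data.Nat using (ℕ; zero; suc; _+_; _≤_; _<_; z≤n; s≤s; _≤?_; _<?_)
import Data.Nat.Properties as ℕ
open import Data.Nat.Induction using (<-wellFounded)
import Data.Integer as ℤ
import Data.Integer.Properties as ℤₚ
open import Data.Bool using (Bool; true; false; _∧_; _∨_)
open import Data.Bool.Properties using (∧-conicalˡ; ∧-conicalʳ; ∨-zeroʳ)
open import Data.Fin using (Fin; zero; suc)
open import Data.Fin.Properties using (any?)
open import Data.Fin.Subset
  using (Subset; _∈_; _∉_; _⊆_; ∣_∣; _∩_; _∪_; _─_; _-_; ∁; ⁅_⁆; Nonempty; Empty; inside; outside)
open import Data.Fin.Subset.Properties
open import Data.Vec using (_∷_; []; here; there; tabulate)
open import Data.Vec.Properties using (lookup⇒[]=; []=⇒lookup; lookup∘tabulate)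
open import Data.Product using (Σ; ∃; ∃-syntax; _×_; _,_; proj₁; proj₂; swap)
open import Data.Sum using (inj₁; inj₂)
open import Data.Empty using (⊥-elim)
open import Function using (_∘_; id; const)
open import Function.Bundles using (_⇔_; mk⇔; Equivalence)
import Induction.WellFounded as WF
import Relation.Binary.Construct.On as On
open import Relation.Binary.PropositionalEquality
  using (_≡_; _≢_; refl; trans; cong; cong₂; subst; subst₂; module ≡-Reasoning)
  renaming (sym to ≡-sym)
open import Relation.Nullary using (¬_; Dec; yes; no; ¬?)
open import Relation.Nullary.Decidable using (_×-dec_; decidable-stable)

private
  variable
    n : ℕ
    x y : Fin n
    a c p q s t : Subset n

mem⇒∈ : ∀ (p : Subset n) x → mem p x ≡ true → x ∈ p
mem⇒∈ p x = lookup⇒[]= x p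

∈⇒mem : x ∈ p → mem p x ≡ true
∈⇒mem = []=⇒lookup

anyFin⁻ : ∀ (f : Fin n → Bool) → anyFin f ≡ true → ∃[ i ] f i ≡ true
anyFin⁻ {zero}  f ()
anyFin⁻ {suc n} f e with f zero in f0
... | true  = zero , f0
... | false = let i , fi = anyFin⁻ (f ∘ suc) e in suc i , fi

anyFin⁺ : ∀ (f : Fin n → Bool) i → f i ≡ true → anyFin f ≡ true
anyFin⁺ f zero    e rewrite e = refl
anyFin⁺ f (suc i) e = trans (cong (f zero ∨_) (anyFin⁺ (f ∘ suc) i e)) (∨-zeroʳ (f zero))

∧≡true⁻ : ∀ {a b} → a ∧ b ≡ true → a ≡ true × b ≡ true
∧≡true⁻ e = ∧-conicalˡ _ _ e , ∧-conicalʳ _ _ e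

BoolRel : ℕ → Set
BoolRel n = Fin n → Fin n → Bool

private
  variable
    r : BoolRel n

image : BoolRel n → Subset n → Subset n
image r p = tabulate λ y → anyFin λ x → mem p x ∧ r x y

∈-image⁺ : ∀ r → x ∈ p → r x y ≡ true → y ∈ image r p
∈-image⁺ {x = x} {p = p} {y = y} r x∈p rxy = mem⇒∈ (image r p) y
  (trans (lookup∘tabulate _ y) (anyFin⁺ _ x (cong₂ _∧_ (∈⇒mem x∈p) rxy)))

∈-image⁻ : ∀ r p → y ∈ image r p → ∃[ x ] x ∈ p × r x y ≡ true
∈-image⁻ {y = y} r p y∈ with anyFin⁻ _ (trans (≡-sym (lookup∘tabulate _ y)) (∈⇒mem y∈))
... | x , e = let p[x] , rxy = ∧≡true⁻ e in x , mem⇒∈ p x p[x] , rxy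

_↾_ : BoolRel n → Subset n → BoolRel n
(r ↾ t) x y = r x y ∧ mem t y

↾⁺ : ∀ r → r x y ≡ true → y ∈ t → (r ↾ t) x y ≡ true
↾⁺ _ rxy y∈t = cong₂ _∧_ rxy (∈⇒mem y∈t)

↾⁻ : ∀ r t → (r ↾ t) x y ≡ true → r x y ≡ true × y ∈ t
↾⁻ {y = y} _ t e = let rxy , t[y] = ∧≡true⁻ e in rxy , mem⇒∈ t y t[y]

x∈p─q⁻ : ∀ (p q : Subset n) → x ∈ p ─ q → x ∈ p × x ∉ q
x∈p─q⁻ (inside  ∷ p) (outside ∷ q) here = here , λ ()
x∈p─q⁻ {x = zero} (inside  ∷ p) (inside  ∷ q) ()
x∈p─q⁻ {x = zero} (outside ∷ p) (inside  ∷ q) ()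
x∈p─q⁻ {x = zero} (outside ∷ p) (outside ∷ q) ()
x∈p─q⁻ (_ ∷ p) (_ ∷ q) (there x∈p─q) =
  let x∈p , x∉q = x∈p─q⁻ p q x∈p─q in there x∈p , x∉q ∘ drop-there

∣p∣≡∣p─q∣+∣p∩q∣ : ∀ (p q : Subset n) → ∣ p ∣ ≡ ∣ p ─ q ∣ + ∣ p ∩ q ∣
∣p∣≡∣p─q∣+∣p∩q∣ []            []            = refl
∣p∣≡∣p─q∣+∣p∩q∣ (outside ∷ p) (outside ∷ q) = ∣p∣≡∣p─q∣+∣p∩q∣ p q
∣p∣≡∣p─q∣+∣p∩q∣ (outside ∷ p) (inside  ∷ q) = ∣p∣≡∣p─q∣+∣p∩q∣ p q
∣p∣≡∣p─q∣+∣p∩q∣ (inside  ∷ p) (outside ∷ q) = cong suc (∣p∣≡∣p─q∣+∣p∩q∣ p q)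
∣p∣≡∣p─q∣+∣p∩q∣ (inside  ∷ p) (inside  ∷ q) =
  trans (cong suc (∣p∣≡∣p─q∣+∣p∩q∣ p q)) (≡-sym (ℕ.+-suc _ _))

∣p∣≤∣p─q∣+∣q∣ : ∀ (p q : Subset n) → ∣ p ∣ ≤ ∣ p ─ q ∣ + ∣ q ∣
∣p∣≤∣p─q∣+∣q∣ p q = begin
  ∣ p ∣                 ≡⟨ ∣p∣≡∣p─q∣+∣p∩q∣ p q ⟩
  ∣ p ─ q ∣ + ∣ p ∩ q ∣ ≤⟨ ℕ.+-monoʳ-≤ ∣ p ─ q ∣ (∣p∩q∣≤∣q∣ p q) ⟩
  ∣ p ─ q ∣ + ∣ q ∣     ∎
  where open ℕ.≤-Reasoning

∣p∣≤1+∣p-x∣ : ∀ (p : Subset n) x → ∣ p ∣ ≤ suc ∣ p - x ∣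
∣p∣≤1+∣p-x∣ p x = begin
  ∣ p ∣               ≤⟨ ∣p∣≤∣p─q∣+∣q∣ p ⁅ x ⁆ ⟩
  ∣ p - x ∣ + ∣ ⁅ x ⁆ ∣ ≡⟨ cong (∣ p - x ∣ +_) (∣⁅x⁆∣≡1 x) ⟩
  ∣ p - x ∣ + 1       ≡⟨ ℕ.+-comm ∣ p - x ∣ 1 ⟩
  suc ∣ p - x ∣       ∎
  where open ℕ.≤-Reasoning

disjoint⇒∣p∣+∣q∣≤∣u∣ : ∀ {p q u : Subset n} →
                       p ⊆ u → q ⊆ u → (∀ {x} → x ∈ p → x ∉ q) → ∣ p ∣ + ∣ q ∣ ≤ ∣ u ∣
disjoint⇒∣p∣+∣q∣≤∣u∣ {p = p} {q} {u} p⊆u q⊆u p∩q≡∅ = begin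
  ∣ p ∣ + ∣ q ∣         ≤⟨ ℕ.+-mono-≤ (p⊆q⇒∣p∣≤∣q∣ p⊆u∩p) (p⊆q⇒∣p∣≤∣q∣ q⊆u─p) ⟩
  ∣ u ∩ p ∣ + ∣ u ─ p ∣ ≡⟨ ℕ.+-comm ∣ u ∩ p ∣ ∣ u ─ p ∣ ⟩
  ∣ u ─ p ∣ + ∣ u ∩ p ∣ ≡⟨ ∣p∣≡∣p─q∣+∣p∩q∣ u p ⟨
  ∣ u ∣                 ∎
  where
  open ℕ.≤-Reasoning
  p⊆u∩p : p ⊆ u ∩ p
  p⊆u∩p x∈p = x∈p∩q⁺ (p⊆u x∈p , x∈p)
  q⊆u─p : q ⊆ u ─ p
  q⊆u─p x∈q = x∈p∧x∉q⇒x∈p─q (q⊆u x∈q) (λ x∈p → p∩q≡∅ x∈p x∈q)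

empty⇒∣p∣≡0 : ∀ {n} {p : Subset n} → Empty p → ∣ p ∣ ≡ 0
empty⇒∣p∣≡0 {n} p-empty = trans (cong ∣_∣ (Empty-unique p-empty)) (∣⊥∣≡0 n)

0<∣p∣⇒nonempty : 0 < ∣ p ∣ → Nonempty p
0<∣p∣⇒nonempty {p = p} 0<∣p∣ with nonempty? p
... | yes p≢∅   = p≢∅
... | no  p-empty = ⊥-elim (ℕ.<⇒≢ 0<∣p∣ (≡-sym (empty⇒∣p∣≡0 p-empty)))

x∈p∧x∉q⇒∣p∩q∣<∣p∣ : x ∈ p → x ∉ q → ∣ p ∩ q ∣ < ∣ p ∣
x∈p∧x∉q⇒∣p∩q∣<∣p∣ {x = x} {p = p} {q = q} x∈p x∉q =
  ℕ.≤-<-trans (p⊆q⇒∣p∣≤∣q∣ p∩q⊆p-x) (x∈p⇒∣p-x∣<∣p∣ x∈p)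
  where
  p∩q⊆p-x : p ∩ q ⊆ p - x
  p∩q⊆p-x y∈p∩q = let y∈p , y∈q = x∈p∩q⁻ p q y∈p∩q in
    x∈p∧x≢y⇒x∈p-y y∈p λ { refl → x∉q y∈q }

Below : (Subset n → Set) → Subset n → Set
Below P p = ∀ q → ∣ q ∣ < ∣ p ∣ → P q

subset-rec : (P : Subset n → Set) → (∀ p → Below P p → P p) → ∀ p → P p
subset-rec P step = WF.All.wfRec (On.wellFounded ∣_∣ <-wellFounded) _ P λ p ih → step p λ q → ih

InjectiveOn : Subset n → (Fin n → Fin n) → Set
InjectiveOn p f = ∀ x y → x ∈ p → y ∈ p → f x ≡ f y → x ≡ y

injective⇒∣p∣≤∣q∣ : ∀ {f : Fin n → Fin n} →
                    (∀ x → x ∈ p → f x ∈ q) → InjectiveOn p f → ∣ p ∣ ≤ ∣ q ∣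
injective⇒∣p∣≤∣q∣ {p = p} {q = q} {f = f} = subset-rec Bound step p q
  where
  Bound : Subset _ → Set
  Bound p = ∀ q → (∀ x → x ∈ p → f x ∈ q) → InjectiveOn p f → ∣ p ∣ ≤ ∣ q ∣
  step : ∀ p → Below Bound p → Bound p
  step p ih q f[p]⊆q f-inj with nonempty? p
  ... | no  p-empty = ℕ.≤-trans (ℕ.≤-reflexive (empty⇒∣p∣≡0 p-empty)) z≤n
  ... | yes (x , x∈p) = begin
    ∣ p ∣               ≤⟨ ∣p∣≤1+∣p-x∣ p x ⟩
    suc ∣ p - x ∣       ≤⟨ s≤s (ih (p - x) (x∈p⇒∣p-x∣<∣p∣ x∈p) (q - f x) maps inj) ⟩
    suc ∣ q - f x ∣     ≤⟨ x∈p⇒∣p-x∣<∣p∣ (f[p]⊆q x x∈p) ⟩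
    ∣ q ∣               ∎
    where
    open ℕ.≤-Reasoning
    maps : ∀ y → y ∈ p - x → f y ∈ q - f x
    maps y y∈p-x = let y∈p , y∉⁅x⁆ = x∈p─q⁻ p ⁅ x ⁆ y∈p-x in
      x∈p∧x≢y⇒x∈p-y (f[p]⊆q y y∈p) (x∉⁅y⁆⇒x≢y y∉⁅x⁆ ∘ f-inj y x y∈p x∈p)
    inj : InjectiveOn (p - x) f
    inj y z y∈ z∈ = f-inj y z (proj₁ (x∈p─q⁻ p ⁅ x ⁆ y∈)) (proj₁ (x∈p─q⁻ p ⁅ x ⁆ z∈))

HallCondition : BoolRel n → Subset n → Set
HallCondition r a = ∀ s → s ⊆ a → ∣ s ∣ ≤ ∣ image r s ∣

Matching : BoolRel n → Subset n → Set
Matching {n} r a =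
  Σ (Fin n → Fin n) λ f → (∀ x → x ∈ a → r x (f x) ≡ true) × InjectiveOn a f

empty-matching : ∀ r → Empty p → Matching r p
empty-matching _ p-empty = id , (λ x x∈p → ⊥-elim (p-empty (x , x∈p)))
                            , (λ x _ x∈p _ _ → ⊥-elim (p-empty (x , x∈p)))

hall⇒neighbour : HallCondition r p → x ∈ p → ∃[ y ] r x y ≡ true
hall⇒neighbour {r = r} {x = x} hall x∈p =
  let y , y∈image      = 0<∣p∣⇒nonempty 0<∣image∣
      x′ , x′∈⁅x⁆ , rx′y = ∈-image⁻ r ⁅ x ⁆ y∈image
  in  y , subst (λ z → r z y ≡ true) (x∈⁅y⁆⇒x≡y x x′∈⁅x⁆) rx′y
  where
  ⁅x⁆⊆p : ⁅ x ⁆ ⊆ _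
  ⁅x⁆⊆p y∈⁅x⁆ = subst (_∈ _) (≡-sym (x∈⁅y⁆⇒x≡y x y∈⁅x⁆)) x∈p
  0<∣image∣ : 0 < ∣ image r ⁅ x ⁆ ∣
  0<∣image∣ = subst (_≤ ∣ image r ⁅ x ⁆ ∣) (∣⁅x⁆∣≡1 x) (hall ⁅ x ⁆ ⁅x⁆⊆p)

image-─⊆image-↾∁ : ∀ (r : BoolRel n) p u → image r p ─ u ⊆ image (r ↾ ∁ u) p
image-─⊆image-↾∁ r p u y∈ =
  let y∈image , y∉u = x∈p─q⁻ (image r p) u y∈
      x , x∈p , rxy  = ∈-image⁻ r p y∈image
  in  ∈-image⁺ (r ↾ ∁ u) x∈p (↾⁺ r rxy (x∉p⇒x∈∁p y∉u))

image-∪-─⊆image-↾∁ : ∀ (r : BoolRel n) p s →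
                     image r (p ∪ s) ─ image r s ⊆ image (r ↾ ∁ (image r s)) p
image-∪-─⊆image-↾∁ r p s y∈ with x∈p─q⁻ (image r (p ∪ s)) (image r s) y∈
... | y∈image , y∉image[s] with ∈-image⁻ r (p ∪ s) y∈image
...   | x , x∈p∪s , rxy with x∈p∪q⁻ p s x∈p∪s
...     | inj₁ x∈p = ∈-image⁺ (r ↾ ∁ (image r s)) x∈p (↾⁺ r rxy (x∉p⇒x∈∁p y∉image[s]))
...     | inj₂ x∈s = ⊥-elim (y∉image[s] (∈-image⁺ r x∈s rxy))

join-matchings : ∀ r (s u : Subset n) →
                 Matching (r ↾ u) s → Matching (r ↾ ∁ u) (a ─ s) → Matching r a
join-matchings {n = n} {a = a} r s u (g , g-r , g-inj) (h , h-r , h-inj) = f , f-r , f-inj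
  where
  f : Fin n → Fin n
  f x with x ∈? s
  ... | yes _ = g x
  ... | no  _ = h x
  h-r′ : ∀ {x} → x ∈ a → x ∉ s → (r ↾ ∁ u) x (h x) ≡ true
  h-r′ x∈a x∉s = h-r _ (x∈p∧x∉q⇒x∈p─q x∈a x∉s)
  separated : ∀ {x y} → x ∈ s → y ∈ a → y ∉ s → g x ≢ h y
  separated x∈s y∈a y∉s gx≡hy = x∈∁p⇒x∉p (proj₂ (↾⁻ r (∁ u) (h-r′ y∈a y∉s)))
    (subst (_∈ u) gx≡hy (proj₂ (↾⁻ r u (g-r _ x∈s))))
  f-r : ∀ x → x ∈ a → r x (f x) ≡ true
  f-r x x∈a with x ∈? s
  ... | yes x∈s = proj₁ (↾⁻ r u (g-r x x∈s))
  ... | no  x∉s = proj₁ (↾⁻ r (∁ u) (h-r′ x∈a x∉s))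
  f-inj : InjectiveOn a f
  f-inj x y x∈a y∈a with x ∈? s | y ∈? s
  ... | yes x∈s | yes y∈s = g-inj x y x∈s y∈s
  ... | yes x∈s | no  y∉s = ⊥-elim ∘ separated x∈s y∈a y∉s
  ... | no  x∉s | yes y∈s = ⊥-elim ∘ separated y∈s x∈a x∉s ∘ ≡-sym
  ... | no  x∉s | no  y∉s = h-inj x y (x∈p∧x∉q⇒x∈p─q x∈a x∉s) (x∈p∧x∉q⇒x∈p─q y∈a y∉s)

HallFor : Subset n → Set
HallFor a = ∀ r → HallCondition r a → Matching r a

Tight : BoolRel n → Subset n → Subset n → Set
Tight r a s = s ⊆ a × Nonempty s × ∣ s ∣ < ∣ a ∣ × ∣ image r s ∣ ≤ ∣ s ∣

tight? : ∀ (r : BoolRel n) a → Dec (∃ (Tight r a))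
tight? r a = anySubset? λ s →
  s ⊆? a ×-dec nonempty? s ×-dec ∣ s ∣ <? ∣ a ∣ ×-dec ∣ image r s ∣ ≤? ∣ s ∣

-- A tight s is matched into image r s, which the rest of a may then avoid.
hall-tight : ∀ r → Below HallFor a → HallCondition r a → Tight r a s → Matching r a
hall-tight {a = a} {s = s} r ih hall (s⊆a , (x , x∈s) , ∣s∣<∣a∣ , s-tight) =
  join-matchings r s u matching-s (ih (a ─ s) ∣a─s∣<∣a∣ (r ↾ ∁ u) hall-rest)
  where
  u = image r s
  matching-s : Matching (r ↾ u) s
  matching-s with ih s ∣s∣<∣a∣ r (λ t t⊆s → hall t (⊆-trans t⊆s s⊆a))
  ... | g , g-r , g-inj = g , (λ y y∈s → ↾⁺ r (g-r y y∈s) (∈-image⁺ r y∈s (g-r y y∈s))) , g-inj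
  ∣a─s∣<∣a∣ : ∣ a ─ s ∣ < ∣ a ∣
  ∣a─s∣<∣a∣ = p∩q≢∅⇒∣p─q∣<∣p∣ a s (x , x∈p∩q⁺ (s⊆a x∈s , x∈s))
  hall-rest : HallCondition (r ↾ ∁ u) (a ─ s)
  hall-rest t t⊆a─s = ℕ.+-cancelʳ-≤ ∣ s ∣ _ _ (begin
    ∣ t ∣ + ∣ s ∣                    ≤⟨ disjoint⇒∣p∣+∣q∣≤∣u∣ (p⊆p∪q s) (q⊆p∪q t s) t∩s≡∅ ⟩
    ∣ t ∪ s ∣                        ≤⟨ hall (t ∪ s) t∪s⊆a ⟩
    ∣ image r (t ∪ s) ∣              ≤⟨ ∣p∣≤∣p─q∣+∣q∣ (image r (t ∪ s)) u ⟩
    ∣ image r (t ∪ s) ─ u ∣ + ∣ u ∣  ≤⟨ ℕ.+-mono-≤ outside-u s-tight ⟩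
    ∣ image (r ↾ ∁ u) t ∣ + ∣ s ∣    ∎)
    where
    open ℕ.≤-Reasoning
    outside-u : ∣ image r (t ∪ s) ─ u ∣ ≤ ∣ image (r ↾ ∁ u) t ∣
    outside-u = p⊆q⇒∣p∣≤∣q∣ (image-∪-─⊆image-↾∁ r t s)
    t∩s≡∅ : ∀ {y} → y ∈ t → y ∉ s
    t∩s≡∅ y∈t = proj₂ (x∈p─q⁻ a s (t⊆a─s y∈t))
    t∪s⊆a : t ∪ s ⊆ a
    t∪s⊆a y∈t∪s with x∈p∪q⁻ t s y∈t∪s
    ... | inj₁ y∈t = proj₁ (x∈p─q⁻ a s (t⊆a─s y∈t))
    ... | inj₂ y∈s = s⊆a y∈s

-- With no tight set, an edge x–y can be used and Hall's condition survives its removal.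
hall-loose : ∀ r → Below HallFor a → HallCondition r a → ¬ ∃ (Tight r a) →
             x ∈ a → Matching r a
hall-loose {a = a} {x = x} r ih hall no-tight x∈a with hall⇒neighbour hall x∈a
... | y , rxy = join-matchings r ⁅ x ⁆ ⁅ y ⁆ matching-x
                  (ih (a - x) (x∈p⇒∣p-x∣<∣p∣ x∈a) (r ↾ ∁ ⁅ y ⁆) hall-rest)
  where
  matching-x : Matching (r ↾ ⁅ y ⁆) ⁅ x ⁆
  matching-x = const y
             , (λ z z∈⁅x⁆ → subst (λ z → (r ↾ ⁅ y ⁆) z y ≡ true) (≡-sym (x∈⁅y⁆⇒x≡y x z∈⁅x⁆))
                                 (↾⁺ r rxy (x∈⁅x⁆ y)))
             , (λ z w z∈⁅x⁆ w∈⁅x⁆ _ → trans (x∈⁅y⁆⇒x≡y x z∈⁅x⁆) (≡-sym (x∈⁅y⁆⇒x≡y x w∈⁅x⁆)))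
  hall-rest : HallCondition (r ↾ ∁ ⁅ y ⁆) (a - x)
  hall-rest t t⊆a-x with nonempty? t
  ... | no  t-empty = ℕ.≤-trans (ℕ.≤-reflexive (empty⇒∣p∣≡0 t-empty)) z≤n
  ... | yes t≢∅     = ℕ.≤-pred (begin
    suc ∣ t ∣                       ≤⟨ ℕ.≰⇒> t-not-tight ⟩
    ∣ image r t ∣                   ≤⟨ ∣p∣≤1+∣p-x∣ (image r t) y ⟩
    suc ∣ image r t - y ∣           ≤⟨ s≤s (p⊆q⇒∣p∣≤∣q∣ (image-─⊆image-↾∁ r t ⁅ y ⁆)) ⟩
    suc ∣ image (r ↾ ∁ ⁅ y ⁆) t ∣   ∎)
    where
    open ℕ.≤-Reasoning
    t⊆a : t ⊆ a
    t⊆a = p─q⊆p a ⁅ x ⁆ ∘ t⊆a-x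
    ∣t∣<∣a∣ : ∣ t ∣ < ∣ a ∣
    ∣t∣<∣a∣ = ℕ.≤-<-trans (p⊆q⇒∣p∣≤∣q∣ t⊆a-x) (x∈p⇒∣p-x∣<∣p∣ x∈a)
    t-not-tight : ¬ ∣ image r t ∣ ≤ ∣ t ∣
    t-not-tight t-tight = no-tight (t , t⊆a , t≢∅ , ∣t∣<∣a∣ , t-tight)

hall-step : ∀ (a : Subset n) → Below HallFor a → HallFor a
hall-step a ih r hall with nonempty? a | tight? r a
... | no  a-empty     | _                 = empty-matching r a-empty
... | yes _           | yes (s , s-tight) = hall-tight r ih hall s-tight
... | yes (x , x∈a)   | no  no-tight      = hall-loose r ih hall no-tight x∈a

hall-theorem : ∀ (r : BoolRel n) a → HallCondition r a → Matching r a
hall-theorem r a = subset-rec HallFor hall-step a r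

⊖-cancelʳ-≤ : ∀ k {m o} → m ℤ.⊖ k ℤ.≤ o ℤ.⊖ k → m ≤ o
⊖-cancelʳ-≤ k {m} {o} m⊖k≤o⊖k with m ≤? o
... | yes m≤o = m≤o
... | no  m≰o = ⊥-elim (ℤₚ.<⇒≱ (ℤₚ.⊖-monoˡ-< k (ℕ.≰⇒> m≰o)) m⊖k≤o⊖k)

[+m]-[+n]≤[+o]-[+p]⇔m+p≤o+n : ∀ m n o p →
  (ℤ.+ m ℤ.- ℤ.+ n ℤ.≤ ℤ.+ o ℤ.- ℤ.+ p) ⇔ (m + p ≤ o + n)
[+m]-[+n]≤[+o]-[+p]⇔m+p≤o+n m n o p =
  mk⇔ (⊖-cancelʳ-≤ (n + p) ∘ subst₂ ℤ._≤_ lhs rhs)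
      (subst₂ ℤ._≤_ (≡-sym lhs) (≡-sym rhs) ∘ ℤₚ.⊖-monoˡ-≤ (n + p))
  where
  shift : ∀ k a b → ℤ.+ a ℤ.- ℤ.+ b ≡ (a + k) ℤ.⊖ (b + k)
  shift k a b = begin
    ℤ.+ a ℤ.- ℤ.+ b        ≡⟨ ℤₚ.[+m]-[+n]≡m⊖n a b ⟩
    a ℤ.⊖ b                ≡⟨ ℤₚ.+-cancelˡ-⊖ k a b ⟨
    (k + a) ℤ.⊖ (k + b)    ≡⟨ cong₂ ℤ._⊖_ (ℕ.+-comm k a) (ℕ.+-comm k b) ⟩
    (a + k) ℤ.⊖ (b + k)    ∎
    where open ≡-Reasoning
  lhs : ℤ.+ m ℤ.- ℤ.+ n ≡ (m + p) ℤ.⊖ (n + p)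
  lhs = shift p m n
  rhs : ℤ.+ o ℤ.- ℤ.+ p ≡ (o + n) ℤ.⊖ (n + p)
  rhs = trans (shift n o p) (cong ((o + n) ℤ.⊖_) (ℕ.+-comm p n))

module _ (G : Graph n) where

  Adj-sym : Adj G x y → Adj G y x
  Adj-sym {x = x} {y = y} = trans (sym G y x)

  ∈-N⁺ : y ∈ p → Adj G x y → x ∈ N G p
  ∈-N⁺ = ∈-image⁺ (λ a x → adj G x a)

  ∈-N⁻ : x ∈ N G p → ∃[ y ] y ∈ p × Adj G x y
  ∈-N⁻ {p = p} = ∈-image⁻ (λ a x → adj G x a) p

  N-mono : p ⊆ q → N G p ⊆ N G q
  N-mono p⊆q x∈N[p] = let y , y∈p , xy = ∈-N⁻ x∈N[p] in ∈-N⁺ (p⊆q y∈p) xy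

  d≤d⇔ : ∀ p q → (d G p ℤ.≤ d G q) ⇔ (∣ p ∣ + ∣ N G q ∣ ≤ ∣ q ∣ + ∣ N G p ∣)
  d≤d⇔ p q = [+m]-[+n]≤[+o]-[+p]⇔m+p≤o+n (∣ p ∣) (∣ N G p ∣) (∣ q ∣) (∣ N G q ∣)

  independent-⊆ : q ⊆ p → Independent G p → Independent G q
  independent-⊆ q⊆p p-ind x y x∈q y∈q = p-ind x y (q⊆p x∈q) (q⊆p y∈q)

  p─N[p]-independent : ∀ p → Independent G (p ─ N G p)
  p─N[p]-independent p x y x∈ y∈ xy =
    proj₂ (x∈p─q⁻ p (N G p) x∈) (∈-N⁺ (proj₁ (x∈p─q⁻ p (N G p) y∈)) xy)

  d[p]≤d[p─N[p]] : ∀ p → d G p ℤ.≤ d G (p ─ N G p)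
  d[p]≤d[p─N[p]] p = Equivalence.from (d≤d⇔ p (p ─ N G p)) (begin
    ∣ p ∣ + ∣ N G p′ ∣                      ≡⟨ cong (_+ ∣ N G p′ ∣) (∣p∣≡∣p─q∣+∣p∩q∣ p (N G p)) ⟩
    ∣ p′ ∣ + ∣ p ∩ N G p ∣ + ∣ N G p′ ∣     ≡⟨ ℕ.+-assoc ∣ p′ ∣ _ _ ⟩
    ∣ p′ ∣ + (∣ p ∩ N G p ∣ + ∣ N G p′ ∣)   ≤⟨ ℕ.+-monoʳ-≤ ∣ p′ ∣ p∩N[p]+N[p′]≤N[p] ⟩
    ∣ p′ ∣ + ∣ N G p ∣                      ∎)
    where
    open ℕ.≤-Reasoning
    p′ = p ─ N G p
    disjoint : ∀ {z} → z ∈ p ∩ N G p → z ∉ N G p′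
    disjoint z∈p∩N[p] z∈N[p′] =
      let w , w∈p′ , zw = ∈-N⁻ z∈N[p′] in
      proj₂ (x∈p─q⁻ p (N G p) w∈p′) (∈-N⁺ (proj₁ (x∈p∩q⁻ p (N G p) z∈p∩N[p])) (Adj-sym zw))
    p∩N[p]+N[p′]≤N[p] : ∣ p ∩ N G p ∣ + ∣ N G p′ ∣ ≤ ∣ N G p ∣
    p∩N[p]+N[p′]≤N[p] = disjoint⇒∣p∣+∣q∣≤∣u∣ (p∩q⊆q p (N G p)) (N-mono (p─q⊆p p (N G p))) disjoint

  -- Replacing s ∩ N(p) by p ─ s in s leaves an independent set.
  ∣p─s∣≤∣s∩N[p]∣ : Independent G p → MaximumIndependent G s → ∣ p ─ s ∣ ≤ ∣ s ∩ N G p ∣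
  ∣p─s∣≤∣s∩N[p]∣ {p = p} {s = s} p-ind (s-ind , s-max) = ℕ.+-cancelʳ-≤ ∣ s ─ N G p ∣ _ _ (begin
    ∣ p ─ s ∣ + ∣ s ─ N G p ∣      ≤⟨ p─s+s─N[p]≤s′ ⟩
    ∣ s′ ∣                          ≤⟨ s-max s′ s′-independent ⟩
    ∣ s ∣                          ≡⟨ ∣p∣≡∣p─q∣+∣p∩q∣ s (N G p) ⟩
    ∣ s ─ N G p ∣ + ∣ s ∩ N G p ∣  ≡⟨ ℕ.+-comm ∣ s ─ N G p ∣ _ ⟩
    ∣ s ∩ N G p ∣ + ∣ s ─ N G p ∣  ∎)
    where
    open ℕ.≤-Reasoning
    s′ = p ∪ (s ─ N G p)
    disjoint : ∀ {z} → z ∈ p ─ s → z ∉ s ─ N G p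
    disjoint z∈p─s z∈s─N[p] = proj₂ (x∈p─q⁻ p s z∈p─s) (proj₁ (x∈p─q⁻ s (N G p) z∈s─N[p]))
    p─s+s─N[p]≤s′ : ∣ p ─ s ∣ + ∣ s ─ N G p ∣ ≤ ∣ s′ ∣
    p─s+s─N[p]≤s′ = disjoint⇒∣p∣+∣q∣≤∣u∣ (p⊆p∪q _ ∘ p─q⊆p p s) (q⊆p∪q p _) disjoint
    s′-independent : Independent G s′
    s′-independent x y x∈s′ y∈s′ with x∈p∪q⁻ p (s ─ N G p) x∈s′ | x∈p∪q⁻ p (s ─ N G p) y∈s′
    ... | inj₁ x∈p | inj₁ y∈p = p-ind x y x∈p y∈p
    ... | inj₁ x∈p | inj₂ y∈s─N[p] =
      proj₂ (x∈p─q⁻ s (N G p) y∈s─N[p]) ∘ ∈-N⁺ x∈p ∘ Adj-sym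
    ... | inj₂ x∈s─N[p] | inj₁ y∈p = proj₂ (x∈p─q⁻ s (N G p) x∈s─N[p]) ∘ ∈-N⁺ y∈p
    ... | inj₂ x∈s─N[p] | inj₂ y∈s─N[p] =
      s-ind x y (proj₁ (x∈p─q⁻ s (N G p) x∈s─N[p])) (proj₁ (x∈p─q⁻ s (N G p) y∈s─N[p]))

  d[p]≤d[p∩s] : Independent G p → MaximumIndependent G s → d G p ℤ.≤ d G (p ∩ s)
  d[p]≤d[p∩s] {p = p} {s = s} p-ind s-max@(s-ind , _) = Equivalence.from (d≤d⇔ p (p ∩ s)) (begin
    ∣ p ∣ + ∣ N G (p ∩ s) ∣                      ≡⟨ cong (_+ ∣ N G (p ∩ s) ∣) ∣p∣≡∣p∩s∣+∣p─s∣ ⟩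
    ∣ p ∩ s ∣ + ∣ p ─ s ∣ + ∣ N G (p ∩ s) ∣      ≡⟨ ℕ.+-assoc ∣ p ∩ s ∣ _ _ ⟩
    ∣ p ∩ s ∣ + (∣ p ─ s ∣ + ∣ N G (p ∩ s) ∣)    ≤⟨ ℕ.+-monoʳ-≤ ∣ p ∩ s ∣ (ℕ.+-monoˡ-≤ _ exchange) ⟩
    ∣ p ∩ s ∣ + (∣ s ∩ N G p ∣ + ∣ N G (p ∩ s) ∣) ≤⟨ ℕ.+-monoʳ-≤ ∣ p ∩ s ∣ s∩N[p]+N[p∩s]≤N[p] ⟩
    ∣ p ∩ s ∣ + ∣ N G p ∣                        ∎)
    where
    open ℕ.≤-Reasoning
    ∣p∣≡∣p∩s∣+∣p─s∣ : ∣ p ∣ ≡ ∣ p ∩ s ∣ + ∣ p ─ s ∣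
    ∣p∣≡∣p∩s∣+∣p─s∣ = trans (∣p∣≡∣p─q∣+∣p∩q∣ p s) (ℕ.+-comm ∣ p ─ s ∣ _)
    exchange : ∣ p ─ s ∣ ≤ ∣ s ∩ N G p ∣
    exchange = ∣p─s∣≤∣s∩N[p]∣ p-ind s-max
    disjoint : ∀ {z} → z ∈ s ∩ N G p → z ∉ N G (p ∩ s)
    disjoint z∈s∩N[p] z∈N[p∩s] =
      let w , w∈p∩s , zw = ∈-N⁻ z∈N[p∩s] in
      s-ind _ w (proj₁ (x∈p∩q⁻ s (N G p) z∈s∩N[p])) (proj₂ (x∈p∩q⁻ p s w∈p∩s)) zw
    s∩N[p]+N[p∩s]≤N[p] : ∣ s ∩ N G p ∣ + ∣ N G (p ∩ s) ∣ ≤ ∣ N G p ∣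
    s∩N[p]+N[p∩s]≤N[p] = disjoint⇒∣p∣+∣q∣≤∣u∣ (p∩q⊆q s (N G p)) (N-mono (p∩q⊆p p s)) disjoint

  matching⇒d[p]≤d[c] : MatchingInto G (N G c) c → p ⊆ c → d G p ℤ.≤ d G c
  matching⇒d[p]≤d[c] {c = c} {p = p} (f , f-into , f-inj) p⊆c = Equivalence.from (d≤d⇔ p c) (begin
    ∣ p ∣ + ∣ N G c ∣                        ≤⟨ ℕ.+-monoʳ-≤ ∣ p ∣ (∣p∣≤∣p─q∣+∣q∣ (N G c) (N G p)) ⟩
    ∣ p ∣ + (∣ N G c ─ N G p ∣ + ∣ N G p ∣)  ≤⟨ ℕ.+-monoʳ-≤ ∣ p ∣ (ℕ.+-monoˡ-≤ _ N[c]─N[p]≤c─p) ⟩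
    ∣ p ∣ + (∣ c ─ p ∣ + ∣ N G p ∣)          ≡⟨ ℕ.+-assoc ∣ p ∣ _ _ ⟨
    ∣ p ∣ + ∣ c ─ p ∣ + ∣ N G p ∣            ≤⟨ ℕ.+-monoˡ-≤ _ p+c─p≤c ⟩
    ∣ c ∣ + ∣ N G p ∣                        ∎)
    where
    open ℕ.≤-Reasoning
    disjoint : ∀ {z} → z ∈ p → z ∉ c ─ p
    disjoint z∈p z∈c─p = proj₂ (x∈p─q⁻ c p z∈c─p) z∈p
    p+c─p≤c : ∣ p ∣ + ∣ c ─ p ∣ ≤ ∣ c ∣
    p+c─p≤c = disjoint⇒∣p∣+∣q∣≤∣u∣ p⊆c (p─q⊆p c p) disjoint
    maps : ∀ y → y ∈ N G c ─ N G p → f y ∈ c ─ p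
    maps y y∈ = let y∈N[c] , y∉N[p] = x∈p─q⁻ (N G c) (N G p) y∈
                    f[y]∈c , y-f[y] = f-into y y∈N[c]
                in x∈p∧x∉q⇒x∈p─q f[y]∈c (λ f[y]∈p → y∉N[p] (∈-N⁺ f[y]∈p y-f[y]))
    N[c]─N[p]≤c─p : ∣ N G c ─ N G p ∣ ≤ ∣ c ─ p ∣
    N[c]─N[p]≤c─p = injective⇒∣p∣≤∣q∣ maps λ x y x∈ y∈ →
      f-inj x y (proj₁ (x∈p─q⁻ (N G c) (N G p) x∈)) (proj₁ (x∈p─q⁻ (N G c) (N G p) y∈))

  module _ (c : Subset n) (c-core : IsCore G c) (matching : MatchingInto G (N G c) c) where

    -- A vertex v ∈ p outside the core is missed by some maximum independent s, and p ∩ s is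
    -- smaller with d(p) ≤ d(p ∩ s).  Such an s is only known to exist classically, which
    -- suffices because the goal is decidable.
    independent⇒d[p]≤d[core] : ∀ p → Independent G p → d G p ℤ.≤ d G c
    independent⇒d[p]≤d[core] = subset-rec _ step
      where
      step : ∀ p → Below (λ q → Independent G q → d G q ℤ.≤ d G c) p →
             Independent G p → d G p ℤ.≤ d G c
      step p ih p-ind with any? (λ v → v ∈? p ×-dec ¬? (v ∈? c))
      ... | no  p⊈c = matching⇒d[p]≤d[c] matching λ {v} v∈p →
                        decidable-stable (v ∈? c) λ v∉c → p⊈c (v , v∈p , v∉c)
      ... | yes (v , v∈p , v∉c) = decidable-stable (d G p ℤₚ.≤? d G c) λ p≰c →
                                     v∉c (proj₂ (c-core v) (in-every-maximum p≰c))
        where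
        in-every-maximum : ¬ d G p ℤ.≤ d G c → ∀ s → MaximumIndependent G s → v ∈ s
        in-every-maximum p≰c s s-max = decidable-stable (v ∈? s) λ v∉s → p≰c (ℤₚ.≤-trans
          (d[p]≤d[p∩s] p-ind s-max)
          (ih (p ∩ s) (x∈p∧x∉q⇒∣p∩q∣<∣p∣ v∈p v∉s) (independent-⊆ (p∩q⊆p p s) p-ind)))

    core-critical : Critical G c
    core-critical p = ℤₚ.≤-trans (d[p]≤d[p─N[p]] p)
                                (independent⇒d[p]≤d[core] (p ─ N G p) (p─N[p]-independent p))

  critical⇒hall-condition : ∀ c → Critical G c → HallCondition (adj G ↾ c) (N G c)
  critical⇒hall-condition c c-critical s s⊆N[c] =
    ℕ.≤-trans ∣s∣≤∣c∩N[s]∣ (p⊆q⇒∣p∣≤∣q∣ c∩N[s]⊆image)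
    where
    c′ = c ─ N G s
    disjoint : ∀ {z} → z ∈ s → z ∉ N G c′
    disjoint z∈s z∈N[c′] =
      let w , w∈c′ , zw = ∈-N⁻ z∈N[c′] in
      proj₂ (x∈p─q⁻ c (N G s) w∈c′) (∈-N⁺ z∈s (Adj-sym zw))
    s+N[c′]≤N[c] : ∣ s ∣ + ∣ N G c′ ∣ ≤ ∣ N G c ∣
    s+N[c′]≤N[c] = disjoint⇒∣p∣+∣q∣≤∣u∣ s⊆N[c] (N-mono (p─q⊆p c (N G s))) disjoint
    ∣s∣≤∣c∩N[s]∣ : ∣ s ∣ ≤ ∣ c ∩ N G s ∣
    ∣s∣≤∣c∩N[s]∣ = ℕ.+-cancelʳ-≤ ∣ N G c′ ∣ _ _ (ℕ.+-cancelˡ-≤ ∣ c′ ∣ _ _ (begin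
      ∣ c′ ∣ + (∣ s ∣ + ∣ N G c′ ∣)          ≤⟨ ℕ.+-monoʳ-≤ ∣ c′ ∣ s+N[c′]≤N[c] ⟩
      ∣ c′ ∣ + ∣ N G c ∣                     ≤⟨ Equivalence.to (d≤d⇔ c′ c) (c-critical c′) ⟩
      ∣ c ∣ + ∣ N G c′ ∣                     ≡⟨ cong (_+ ∣ N G c′ ∣) (∣p∣≡∣p─q∣+∣p∩q∣ c (N G s)) ⟩
      ∣ c′ ∣ + ∣ c ∩ N G s ∣ + ∣ N G c′ ∣    ≡⟨ ℕ.+-assoc ∣ c′ ∣ _ _ ⟩
      ∣ c′ ∣ + (∣ c ∩ N G s ∣ + ∣ N G c′ ∣)  ∎))
      where open ℕ.≤-Reasoning
    c∩N[s]⊆image : c ∩ N G s ⊆ image (adj G ↾ c) s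
    c∩N[s]⊆image y∈c∩N[s] =
      let y∈c , y∈N[s] = x∈p∩q⁻ c (N G s) y∈c∩N[s]
          z , z∈s , yz  = ∈-N⁻ {p = s} y∈N[s]
      in  ∈-image⁺ (adj G ↾ c) z∈s (↾⁺ (adj G) (Adj-sym yz) y∈c)

  critical⇒matching : ∀ c → Critical G c → MatchingInto G (N G c) c
  critical⇒matching c c-critical
    with hall-theorem (adj G ↾ c) (N G c) (critical⇒hall-condition c c-critical)
  ... | f , f-adj , f-inj = f , (λ x x∈N[c] → swap (↾⁻ (adj G) c (f-adj x x∈N[c]))) , f-inj

corollary2p16 : ∀ {n} (G : Graph n) (C : Subset n) → IsCore G C →
                  (Critical G C → MatchingInto G (N G C) C)
                  × (MatchingInto G (N G C) C → Critical G C)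
corollary2p16 G C C-core = critical⇒matching G C , core-critical G C C-core
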